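{- For all positive integers $\ell$ and $t$, the $\ell$-cycle of strict half-graphs of height $t$ has twin-width at most $3$.
   Context: The $\ell$-cycle of strict half-graphs of height $t$ is the graph with vertex set $\{a^p_i : p\in[0,\ell-1], i\in[t]\}$ and edge set $\{a^p_i a^{(p+1) \bmod \ell}_j : i<j,\ i,j\in[t],\ p\in[0,\ell-1]\}$. Twin-width: a trigraph has disjoint black and red edge sets; a graph is a trigraph with no red edges. Contracting distinct $u,v$ into a new vertex $z$ makes vertices adjacent (by any edge) to exactly one of $u,v$ red neighbours of $z$, a common neighbour $x$ a black neighbour if $ux,vx$ are both black and a red neighbour otherwise, other edges unchanged. A $d$-sequence of an $n$-vertex trigraph $G$ is a sequence $G=G_n,\dots,G_1$ of trigraphs of red degree at most $d$, each obtained from the previous by one contraction; the twin-width is the least $d$ for which one exists. -}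

module Defs where

open import Data.Nat using (ℕ; zero; suc; _≤_; _<ᵇ_; _≡ᵇ_; _*_)
open import Data.Bool using (Bool; true; false; _∧_; _∨_; if_then_else_)
open import Data.Fin using (Fin; toℕ; remQuot)
open import Data.List using (length; filter)
open import Data.List.Base using (allFin)
open import Data.Product using (Σ; _×_; _,_; proj₁; proj₂)
open import Data.Sum using (_⊎_)
open import Relation.Binary.PropositionalEquality using (_≡_; _≢_)
open import Relation.Nullary using (Dec; yes; no)
open import Relation.Nullary.Negation using (¬_)

data EdgeKind : Set where
  none black red : EdgeKind

_≟ₑ_ : (a b : EdgeKind) → Dec (a ≡ b)
none  ≟ₑ none  = yes _≡_.refl
none  ≟ₑ black = no λ ()
none  ≟ₑ red   = no λ ()
black ≟ₑ none  = no λ ()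
black ≟ₑ black = yes _≡_.refl
black ≟ₑ red   = no λ ()
red   ≟ₑ none  = no λ ()
red   ≟ₑ black = no λ ()
red   ≟ₑ red   = yes _≡_.refl

-- A trigraph on vertex set Fin n: a symmetric, loopless assignment of
-- edge kinds (black and red edge sets are disjoint by construction).
record Trigraph (n : ℕ) : Set where
  field
    edge  : Fin n → Fin n → EdgeKind
    sym   : ∀ x y → edge x y ≡ edge y x
    loop  : ∀ x → edge x x ≡ none
open Trigraph public

redDeg : ∀ {n} → Trigraph n → Fin n → ℕ
redDeg {n} G v = length (filter (λ w → edge G v w ≟ₑ red) (allFin n))

RedDegAtMost : ∀ {n} → ℕ → Trigraph n → Set
RedDegAtMost d G = ∀ v → redDeg G v ≤ d

merge : EdgeKind → EdgeKind → EdgeKind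
merge none  none  = none
merge black black = black
merge _     _     = red

-- The new vertex set is
-- identified with Fin n via a map f : Fin (suc n) → Fin n which sends u and
-- v to z = f u = f v, is surjective, and is injective apart from u,v.
record ContractionOf {n : ℕ} (G : Trigraph (suc n)) (G' : Trigraph n) : Set where
  field
    u v     : Fin (suc n)
    u≢v     : u ≢ v
    f       : Fin (suc n) → Fin n
    fu≡fv   : f u ≡ f v
    f-inj   : ∀ x y → f x ≡ f y → x ≡ y ⊎ ((x ≡ u × y ≡ v) ⊎ (x ≡ v × y ≡ u))
    f-surj  : ∀ a → Σ (Fin (suc n)) (λ x → f x ≡ a)
    keep    : ∀ x y → x ≢ u → x ≢ v → y ≢ u → y ≢ v →
              edge G' (f x) (f y) ≡ edge G x y
    new     : ∀ x → x ≢ u → x ≢ v →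
              edge G' (f u) (f x) ≡ merge (edge G u x) (edge G v x)

HasDSequence : ℕ → ∀ {n} → Trigraph n → Set
HasDSequence d {zero}        G = RedDegAtMost d G
HasDSequence d {suc zero}    G = RedDegAtMost d G
HasDSequence d {suc (suc n)} G =
  RedDegAtMost d G × Σ (Trigraph (suc n)) (λ G' → ContractionOf G G' × HasDSequence d G')

TwinWidthAtMost : ℕ → ∀ {n} → Trigraph n → Set
TwinWidthAtMost d G = HasDSequence d G

IsSuccMod : (ℓ : ℕ) → Fin ℓ → Fin ℓ → Bool
IsSuccMod ℓ p q = (toℕ q ≡ᵇ suc (toℕ p)) ∨ ((toℕ q ≡ᵇ 0) ∧ (suc (toℕ p) ≡ᵇ ℓ))

-- Adjacency of a^p_i and a^q_j (i, j ∈ Fin t stand for i+1, j+1 ∈ [t]):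
-- edges a^p_i a^{p+1 mod ℓ}_j with i < j.
halfAdj : (ℓ t : ℕ) → Fin ℓ × Fin t → Fin ℓ × Fin t → Bool
halfAdj ℓ t (p , i) (q , j) =
  (IsSuccMod ℓ p q ∧ (toℕ i <ᵇ toℕ j)) ∨ (IsSuccMod ℓ q p ∧ (toℕ j <ᵇ toℕ i))

-- vertex x : Fin (ℓ * t) encodes the pair (p , i) = remQuot t x
cycleEdge : (ℓ t : ℕ) → Fin (ℓ * t) → Fin (ℓ * t) → EdgeKind
cycleEdge ℓ t x y = if halfAdj ℓ t (remQuot t x) (remQuot t y) then black else none

private
  <ᵇ-irrefl : ∀ m → (m <ᵇ m) ≡ false
  <ᵇ-irrefl zero    = _≡_.refl
  <ᵇ-irrefl (suc m) = <ᵇ-irrefl m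

  ∧-false : ∀ b → (b ∧ false) ≡ false
  ∧-false true  = _≡_.refl
  ∧-false false = _≡_.refl

  ∨-comm' : ∀ a b → (a ∨ b) ≡ (b ∨ a)
  ∨-comm' true  true  = _≡_.refl
  ∨-comm' true  false = _≡_.refl
  ∨-comm' false true  = _≡_.refl
  ∨-comm' false false = _≡_.refl

  halfAdj-sym : ∀ ℓ t a b → halfAdj ℓ t a b ≡ halfAdj ℓ t b a
  halfAdj-sym ℓ t (p , i) (q , j) =
    ∨-comm' (IsSuccMod ℓ p q ∧ (toℕ i <ᵇ toℕ j)) (IsSuccMod ℓ q p ∧ (toℕ j <ᵇ toℕ i))

  halfAdj-loop : ∀ ℓ t a → halfAdj ℓ t a a ≡ false
  halfAdj-loop ℓ t (p , i) rewrite <ᵇ-irrefl (toℕ i) | ∧-false (IsSuccMod ℓ p p) = _≡_.refl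

  cycleEdge-sym : ∀ ℓ t x y → cycleEdge ℓ t x y ≡ cycleEdge ℓ t y x
  cycleEdge-sym ℓ t x y rewrite halfAdj-sym ℓ t (remQuot t x) (remQuot t y) = _≡_.refl

  cycleEdge-loop : ∀ ℓ t x → cycleEdge ℓ t x x ≡ none
  cycleEdge-loop ℓ t x rewrite halfAdj-loop ℓ t (remQuot t x) = _≡_.refl

HalfGraphCycle : (ℓ t : ℕ) → Trigraph (ℓ * t)
HalfGraphCycle ℓ t = record
  { edge = cycleEdge ℓ t
  ; sym  = cycleEdge-sym ℓ t
  ; loop = cycleEdge-loop ℓ t }

-- Number the vertex a^p_i (rows counted from 0) by i * ℓ + p and repeatedly contract the vertex
-- with the largest number into the vertex of its column one row below. At every stage each column
-- consists of singleton rows under one top part, and the top rows of any two columns differ by at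
-- most one. A red edge between two parts needs a vertex of one part that sees two vertices of the
-- other part differently; hence a part of column p can only be red to the top parts of columns
-- p ± 1 and to the part of column p - 1 at its own level, so the red degree stays at most 3. Once
-- every column is a single part the parts form a cycle, and merging the last column into its
-- predecessor keeps the red degree at most 3 until a single vertex is left.

module Submission where

open import Defs hiding (sym)
open import Data.Bool as Bool using (Bool; true; false; _∧_; _∨_; if_then_else_)
open import Data.Bool.Properties using (∨-zeroʳ; ∧-zeroʳ; ∧-identityʳ; T-≡)
open import Data.Empty using (⊥-elim)
open import Data.Fin using (Fin; toℕ; fromℕ; fromℕ<; inject₁; remQuot; combine; cast; _≟_)
open import Data.Fin.Properties
  using (toℕ-injective; toℕ<n; toℕ≤pred[n]; toℕ-fromℕ; toℕ-fromℕ<; toℕ-inject₁; fromℕ≢inject₁; toℕ-cast;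
         cast-involutive; toℕ-combine; remQuot-combine; combine-remQuot; any?)
open import Data.Fin.Relation.Unary.Top using (view; ‵fromℕ; ‵inject₁; view-fromℕ; view-inject₁)
open import Data.List using (List; []; _∷_; length; filter; map; _++_; allFin)
open import Data.List.Properties using (length-map; length-++)
open import Data.List.Membership.Propositional using (_∈_)
open import Data.List.Membership.Propositional.Properties
  using (∈-map⁻; ∈-filter⁻; ∈-∃++; ∈-++⁻; ∈-++⁺ˡ; ∈-++⁺ʳ)
open import Data.List.Relation.Unary.All as All using ()
open import Data.List.Relation.Unary.AllPairs using (_∷_)
open import Data.List.Relation.Unary.Any using (here; there)
open import Data.List.Relation.Unary.Unique.Propositional using (Unique)
open import Data.List.Relation.Unary.Unique.Propositional.Properties using (map⁺; filter⁺; allFin⁺)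
open import Data.Nat
  using (ℕ; zero; suc; pred; _+_; _*_; _∸_; _⊓_; _≤_; _<_; _<?_; _<ᵇ_; _≡ᵇ_; z≤n; s≤s)
open import Data.Nat.Properties as ℕₚ
  using (≤-refl; ≤-reflexive; ≤-trans; ≤-antisym; ≤-pred; ≤∧≢⇒<; <-irrefl; <-≤-trans; <⇒≤; <⇒≱; <⇒≤pred; ≮⇒≥;
         n≮n; n≤1+n; m≤n⇒m≤1+n; m<n⇒m<1+n; m≤n⇒m<n∨m≡n; m≤m+n; m<n+m; +-suc; +-comm; +-assoc; +-cancelˡ-≡;
         +-monoˡ-≤; +-monoʳ-≤; +-monoˡ-<; *-comm; *-identityʳ; *-monoˡ-≤; *-monoʳ-≤; ∸-monoʳ-<; m+n∸m≡n;
         m≤n⇒m⊓n≡m; m≥n⇒m⊓n≡n; ≡ᵇ⇒≡; <ᵇ⇒<; <⇒<ᵇ; module ≤-Reasoning)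
open import Data.Product using (∃; ∃₂; _×_; _,_; proj₁; proj₂; uncurry)
open import Data.Sum as Sum using (_⊎_; inj₁; inj₂)
open import Function using (_∘_; id; flip; _⇔_; mk⇔; Equivalence)
open import Function.Definitions using (Injective; StrictlySurjective)
open import Relation.Binary.PropositionalEquality
open import Relation.Nullary using (Dec; yes; no; does; ¬_)
open import Relation.Nullary.Decidable using (_×-dec_; _⊎-dec_; ¬?; dec-true; dec-false; does-⇔)

≡true⇒T : ∀ {b} → b ≡ true → Bool.T b
≡true⇒T = Equivalence.from T-≡

suc[m⊓n]⊓n≡suc[m]⊓n : ∀ m n → suc (m ⊓ n) ⊓ n ≡ suc m ⊓ n
suc[m⊓n]⊓n≡suc[m]⊓n zero    n       = refl
suc[m⊓n]⊓n≡suc[m]⊓n (suc m) zero    = refl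
suc[m⊓n]⊓n≡suc[m]⊓n (suc m) (suc n) = cong suc (suc[m⊓n]⊓n≡suc[m]⊓n m n)

m⊓[1+n]<1+n⇒m⊓[1+n]≡m⊓n : ∀ m n → m ⊓ suc n < suc n → m ⊓ suc n ≡ m ⊓ n
m⊓[1+n]<1+n⇒m⊓[1+n]≡m⊓n zero    n       _        = refl
m⊓[1+n]<1+n⇒m⊓[1+n]≡m⊓n (suc m) zero    (s≤s ())
m⊓[1+n]<1+n⇒m⊓[1+n]≡m⊓n (suc m) (suc n) (s≤s lt) = cong suc (m⊓[1+n]<1+n⇒m⊓[1+n]≡m⊓n m n lt)

m⊓[1+n]≮1+n⇒m⊓n≡n : ∀ m n → ¬ m ⊓ suc n < suc n → m ⊓ n ≡ n
m⊓[1+n]≮1+n⇒m⊓n≡n zero    n       ≮ = ⊥-elim (≮ (s≤s z≤n))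
m⊓[1+n]≮1+n⇒m⊓n≡n (suc m) zero    _ = refl
m⊓[1+n]≮1+n⇒m⊓n≡n (suc m) (suc n) ≮ = cong suc (m⊓[1+n]≮1+n⇒m⊓n≡n m n (≮ ∘ s≤s))

*-+-injective : ∀ ℓ {r r′ c c′} → c < ℓ → c′ < ℓ → r * ℓ + c ≡ r′ * ℓ + c′ → r ≡ r′ × c ≡ c′
*-+-injective ℓ {zero}  {zero}                  _   _    e = refl , e
*-+-injective ℓ {zero}  {suc r′} {c′ = c′}      c<ℓ _    e =
  ⊥-elim (<⇒≱ c<ℓ (≤-trans (m≤m+n ℓ (r′ * ℓ)) (≤-trans (m≤m+n _ c′) (≤-reflexive (sym e)))))
*-+-injective ℓ {suc r} {zero}   {c}            _   c′<ℓ e =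
  ⊥-elim (<⇒≱ c′<ℓ (≤-trans (m≤m+n ℓ (r * ℓ)) (≤-trans (m≤m+n _ c) (≤-reflexive e))))
*-+-injective ℓ {suc r} {suc r′} {c} {c′}       c<ℓ c′<ℓ e
  with refl , refl ← *-+-injective ℓ {r} {r′} c<ℓ c′<ℓ
                       (+-cancelˡ-≡ ℓ _ _ (trans (sym (+-assoc ℓ (r * ℓ) c)) (trans e (+-assoc ℓ (r′ * ℓ) c′))))
  = refl , refl

≢⇒true⊎true : ∀ {a b} → a ≢ b → a ≡ true ⊎ b ≡ true
≢⇒true⊎true {true}          _   = inj₁ refl
≢⇒true⊎true {false} {true}  _   = inj₂ refl
≢⇒true⊎true {false} {false} a≢b = ⊥-elim (a≢b refl)

≢⇒false⊎false : ∀ {a b} → a ≢ b → a ≡ false ⊎ b ≡ false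
≢⇒false⊎false {false}        _   = inj₁ refl
≢⇒false⊎false {true} {false} _   = inj₂ refl
≢⇒false⊎false {true} {true}  a≢b = ⊥-elim (a≢b refl)

∧-≢ : ∀ s {b b′} → s ∧ b ≢ s ∧ b′ → s ≡ true × b ≢ b′
∧-≢ true  ne = refl , ne
∧-≢ false ne = ⊥-elim (ne refl)

∧∨∧-≢ : ∀ s₁ s₂ {a a′ b b′} → (s₁ ∧ a) ∨ (s₂ ∧ b) ≢ (s₁ ∧ a′) ∨ (s₂ ∧ b′) →
        (s₁ ≡ true × a ≢ a′) ⊎ (s₂ ≡ true × b ≢ b′)
∧∨∧-≢ s₁ s₂ {a} {a′} ne with s₁ ∧ a Bool.≟ s₁ ∧ a′
... | yes same   = inj₂ (∧-≢ s₂ λ e → ne (cong₂ _∨_ same e))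
... | no  differ = inj₁ (∧-≢ s₁ differ)

∧∨∧≡true : ∀ s₁ s₂ {a b} → (s₁ ∧ a) ∨ (s₂ ∧ b) ≡ true → s₁ ≡ true ⊎ s₂ ≡ true
∧∨∧≡true true  _    _ = inj₁ refl
∧∨∧≡true false true _ = inj₂ refl

<ᵇ-≢⇒< : ∀ i i′ j → (i <ᵇ j) ≢ (i′ <ᵇ j) → i < j ⊎ i′ < j
<ᵇ-≢⇒< i i′ j ne = Sum.map (<ᵇ⇒< i j ∘ ≡true⇒T) (<ᵇ⇒< i′ j ∘ ≡true⇒T) (≢⇒true⊎true ne)

<ᵇ-≢⇒≥ : ∀ i i′ j → (j <ᵇ i) ≢ (j <ᵇ i′) → i ≤ j ⊎ i′ ≤ j
<ᵇ-≢⇒≥ i i′ j ne = Sum.map (false⇒≥ i) (false⇒≥ i′) (≢⇒false⊎false ne)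
  where
  false⇒≥ : ∀ i → (j <ᵇ i) ≡ false → i ≤ j
  false⇒≥ i e = ≮⇒≥ λ j<i → subst Bool.T e (<⇒<ᵇ j<i)

StrictlySurjective-∘ : ∀ {A B C : Set} {f : A → B} {g : B → C} →
                       StrictlySurjective _≡_ f → StrictlySurjective _≡_ g → StrictlySurjective _≡_ (g ∘ f)
StrictlySurjective-∘ f-surj g-surj c with b , refl ← g-surj c with a , refl ← f-surj b = a , refl

Unique-⊆⇒length≤ : ∀ {a} {A : Set a} {xs ys : List A} →
                   Unique xs → (∀ {z} → z ∈ xs → z ∈ ys) → length xs ≤ length ys
Unique-⊆⇒length≤ {xs = []} _ _ = z≤n
Unique-⊆⇒length≤ {xs = x ∷ xs} (x∉xs ∷ unique) xs⊆ys
  with ys₁ , ys₂ , refl ← ∈-∃++ (xs⊆ys (here refl)) = begin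
    suc (length xs)               ≤⟨ s≤s (Unique-⊆⇒length≤ unique xs⊆ys₁++ys₂) ⟩
    suc (length (ys₁ ++ ys₂))     ≡⟨ cong suc (length-++ ys₁) ⟩
    suc (length ys₁ + length ys₂) ≡⟨ +-suc (length ys₁) (length ys₂) ⟨
    length ys₁ + length (x ∷ ys₂) ≡⟨ length-++ ys₁ ⟨
    length (ys₁ ++ x ∷ ys₂)       ∎
  where
  open ≤-Reasoning
  xs⊆ys₁++ys₂ : ∀ {z} → z ∈ xs → z ∈ ys₁ ++ ys₂
  xs⊆ys₁++ys₂ z∈xs with ∈-++⁻ ys₁ (xs⊆ys (there z∈xs))
  ... | inj₁ z∈ys₁          = ∈-++⁺ˡ z∈ys₁
  ... | inj₂ (here refl)    = ⊥-elim (All.lookup x∉xs z∈xs refl)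
  ... | inj₂ (there z∈ys₂)  = ∈-++⁺ʳ ys₁ z∈ys₂

redDeg≤length : ∀ {n} (G : Trigraph n) a (L : List ℕ) →
                (∀ b → edge G a b ≡ red → toℕ b ∈ L) → redDeg G a ≤ length L
redDeg≤length {n} G a L red⇒∈L = begin
  redDeg G a             ≡⟨ length-map toℕ reds ⟨
  length (map toℕ reds)  ≤⟨ Unique-⊆⇒length≤ unique reds⊆L ⟩
  length L               ∎
  where
  open ≤-Reasoning
  isRed = λ w → edge G a w ≟ₑ red
  reds = filter isRed (allFin n)
  unique : Unique (map toℕ reds)
  unique = map⁺ toℕ-injective (filter⁺ isRed (allFin⁺ n))
  reds⊆L : ∀ {z} → z ∈ map toℕ reds → z ∈ L
  reds⊆L z∈ with b , b∈reds , refl ← ∈-map⁻ toℕ z∈ =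
    red⇒∈L b (proj₂ (∈-filter⁻ isRed {xs = allFin n} b∈reds))

noRed⇒RedDegAtMost : ∀ {n} d (G : Trigraph n) → (∀ x y → edge G x y ≢ red) → RedDegAtMost d G
noRed⇒RedDegAtMost d G noRed a = ≤-trans (redDeg≤length G a [] λ b isRed → ⊥-elim (noRed a b isRed)) z≤n

HasDSequence-relabel : ∀ {d n} (G H : Trigraph n) (σ τ : Fin n → Fin n) →
  (∀ y → σ (τ y) ≡ y) → (∀ x → τ (σ x) ≡ x) → (∀ a b → edge G a b ≡ edge H (σ a) (σ b)) →
  RedDegAtMost d G → HasDSequence d H → HasDSequence d G
HasDSequence-relabel {n = zero}        G H σ τ στ τσ G≅H redG _ = redG
HasDSequence-relabel {n = suc zero}    G H σ τ στ τσ G≅H redG _ = redG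
HasDSequence-relabel {n = suc (suc n)} G H σ τ στ τσ G≅H redG (_ , H′ , H→H′ , seq) =
  redG , H′ , G→H′ , seq
  where
  open ContractionOf H→H′
  σ-inj : ∀ {x y} → σ x ≡ σ y → x ≡ y
  σ-inj {x} {y} e = trans (sym (τσ x)) (trans (cong τ e) (τσ y))
  σ⇒τ : ∀ {x z} → σ x ≡ z → x ≡ τ z
  σ⇒τ {x} refl = sym (τσ x)
  σ≢ : ∀ {x z} → x ≢ τ z → σ x ≢ z
  σ≢ x≢τz = x≢τz ∘ σ⇒τ
  at : ∀ z x → edge G (τ z) x ≡ edge H z (σ x)
  at z x = trans (G≅H (τ z) x) (cong (λ w → edge H w (σ x)) (στ z))
  G→H′ : ContractionOf G H′
  G→H′ = record
    { u      = τ u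
    ; v      = τ v
    ; u≢v    = λ e → u≢v (trans (sym (στ u)) (trans (cong σ e) (στ v)))
    ; f      = f ∘ σ
    ; fu≡fv  = trans (cong f (στ u)) (trans fu≡fv (cong f (sym (στ v))))
    ; f-inj  = λ x y e → Sum.map σ-inj
                 (Sum.map (λ (p , r) → σ⇒τ p , σ⇒τ r) (λ (p , r) → σ⇒τ p , σ⇒τ r))
                 (f-inj (σ x) (σ y) e)
    ; f-surj = λ a → τ (proj₁ (f-surj a)) , trans (cong f (στ _)) (proj₂ (f-surj a))
    ; keep   = λ x y x≢u x≢v y≢u y≢v →
                 trans (keep (σ x) (σ y) (σ≢ x≢u) (σ≢ x≢v) (σ≢ y≢u) (σ≢ y≢v)) (sym (G≅H x y))
    ; new    = λ x x≢u x≢v →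
                 trans (cong (λ w → edge H′ (f w) (f (σ x))) (στ u))
                   (trans (new (σ x) (σ≢ x≢u) (σ≢ x≢v)) (sym (cong₂ merge (at u x) (at v x))))
    }

-- Quotient trigraphs

none≢black : none ≢ black
none≢black ()

-- The kind of the edge between two parts, given whether some pair across them is non-black and
-- whether some pair across them is black.
bundleKind : Bool → Bool → EdgeKind
bundleKind false _     = black
bundleKind true  true  = red
bundleKind true  false = none

bundleKind-∨ : ∀ n₁ b₁ n₂ b₂ → n₁ ∨ b₁ ≡ true → n₂ ∨ b₂ ≡ true →
               bundleKind (n₁ ∨ n₂) (b₁ ∨ b₂) ≡ merge (bundleKind n₁ b₁) (bundleKind n₂ b₂)
bundleKind-∨ false false _     _     () _
bundleKind-∨ _     _     false false _  ()
bundleKind-∨ false true  false true  _  _ = refl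
bundleKind-∨ false true  true  false _  _ = refl
bundleKind-∨ false true  true  true  _  _ = refl
bundleKind-∨ true  false false true  _  _ = refl
bundleKind-∨ true  false true  false _  _ = refl
bundleKind-∨ true  false true  true  _  _ = refl
bundleKind-∨ true  true  false true  _  _ = refl
bundleKind-∨ true  true  true  false _  _ = refl
bundleKind-∨ true  true  true  true  _  _ = refl

quotientKind : Bool → Bool → Bool → EdgeKind
quotientKind true  _ _ = none
quotientKind false n b = bundleKind n b

quotientKind-cong : ∀ {e e′ n n′ b b′} → e ≡ e′ → n ≡ n′ → b ≡ b′ →
                    quotientKind e n b ≡ quotientKind e′ n′ b′
quotientKind-cong refl refl refl = refl

record IsMerge {k : ℕ} (u v : Fin (suc k)) (f : Fin (suc k) → Fin k) : Set where
  field
    u≢v    : u ≢ v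
    fu≡fv  : f u ≡ f v
    f-inj  : ∀ x y → f x ≡ f y → x ≡ y ⊎ ((x ≡ u × y ≡ v) ⊎ (x ≡ v × y ≡ u))
    f-surj : StrictlySurjective _≡_ f

  fiber-kept : ∀ {x y} → x ≢ u → x ≢ v → f y ≡ f x → y ≡ x
  fiber-kept {x} {y} x≢u x≢v e with f-inj y x e
  ... | inj₁ y≡x              = y≡x
  ... | inj₂ (inj₁ (_ , x≡v)) = ⊥-elim (x≢v x≡v)
  ... | inj₂ (inj₂ (_ , x≡u)) = ⊥-elim (x≢u x≡u)

  fiber-merged : ∀ {y} → f y ≡ f u → y ≡ u ⊎ y ≡ v
  fiber-merged {y} e with f-inj y u e
  ... | inj₁ y≡u              = inj₁ y≡u
  ... | inj₂ (inj₁ (y≡u , _)) = inj₁ y≡u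
  ... | inj₂ (inj₂ (y≡v , _)) = inj₂ y≡v

-- A partition of the vertices of G into K parts is a map q onto Fin K, and quotient q is the
-- trigraph obtained by contracting every part; contracting two parts then amounts to post-composing
-- q with a map that merges them.
module Quotient {N : ℕ} (G : Trigraph N) where

  module _ {K : ℕ} (q : Fin N → Fin K) where

    Pairs : (EdgeKind → Set) → Fin K → Fin K → Set
    Pairs P a b = ∃₂ λ x y → q x ≡ a × q y ≡ b × P (edge G x y)

    pairs? : ∀ {P} → (∀ k → Dec (P k)) → ∀ a b → Dec (Pairs P a b)
    pairs? P? a b = any? λ x → any? λ y → q x ≟ a ×-dec q y ≟ b ×-dec P? (edge G x y)

    Pairs-swap : ∀ {P a b} → Pairs P a b → Pairs P b a
    Pairs-swap {P} (x , y , qx , qy , p) = y , x , qy , qx , subst P (Trigraph.sym G x y) p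

    SomeNonBlack SomeBlack : Fin K → Fin K → Set
    SomeNonBlack = Pairs (_≢ black)
    SomeBlack    = Pairs (_≡ black)

    someNonBlack? : ∀ a b → Dec (SomeNonBlack a b)
    someNonBlack? = pairs? λ k → ¬? (k ≟ₑ black)

    someBlack? : ∀ a b → Dec (SomeBlack a b)
    someBlack? = pairs? (_≟ₑ black)

    quotientEdge : Fin K → Fin K → EdgeKind
    quotientEdge a b = quotientKind (does (a ≟ b)) (does (someNonBlack? a b)) (does (someBlack? a b))

    quotientEdge-sym : ∀ a b → quotientEdge a b ≡ quotientEdge b a
    quotientEdge-sym a b =
      quotientKind-cong (does-⇔ (mk⇔ sym sym) (a ≟ b) (b ≟ a))
                        (does-⇔ (swap⇔ (_≢ black)) (someNonBlack? a b) (someNonBlack? b a))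
                        (does-⇔ (swap⇔ (_≡ black)) (someBlack? a b) (someBlack? b a))
      where
      swap⇔ : ∀ P → Pairs P a b ⇔ Pairs P b a
      swap⇔ P = mk⇔ (Pairs-swap {P}) (Pairs-swap {P})

    quotientEdge-≢ : ∀ {a b} → a ≢ b →
                     quotientEdge a b ≡ bundleKind (does (someNonBlack? a b)) (does (someBlack? a b))
    quotientEdge-≢ {a} {b} a≢b = quotientKind-cong (dec-false (a ≟ b) a≢b) refl refl

    red⇒pairs : ∀ a b → quotientEdge a b ≡ red → SomeNonBlack a b × SomeBlack a b
    red⇒pairs a b = decided (a ≟ b) (someNonBlack? a b) (someBlack? a b)
      where
      decided : ∀ {E NB B : Set} (e? : Dec E) (nb? : Dec NB) (b? : Dec B) →
                quotientKind (does e?) (does nb?) (does b?) ≡ red → NB × B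
      decided (no _)  (yes nb) (yes bl) _ = nb , bl
      decided (yes _) _        _        ()
      decided (no _)  (no _)   _        ()
      decided (no _)  (yes _)  (no _)   ()

    Splits : Fin K → Fin K → Set
    Splits a b = ∃₂ λ x y → ∃ λ y′ → q x ≡ a × q y ≡ b × q y′ ≡ b × edge G x y ≢ edge G x y′

    red⇒Splits : ∀ a b → quotientEdge a b ≡ red → Splits a b ⊎ Splits b a
    red⇒Splits a b e
      with (x , y , qx , qy , xy≢black) , (x′ , y′ , qx′ , qy′ , x′y′≡black) ← red⇒pairs a b e
      with edge G x y′ ≟ₑ black
    ... | yes xy′≡black = inj₁ (x , y , y′ , qx , qy , qy′ , λ e → xy≢black (trans e xy′≡black))
    ... | no  xy′≢black = inj₂ (y′ , x , x′ , qy′ , qx , qx′ , λ e →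
            xy′≢black (trans (Trigraph.sym G x y′) (trans e (trans (Trigraph.sym G y′ x′) x′y′≡black))))

  quotient : ∀ {K} → (Fin N → Fin K) → Trigraph K
  quotient q = record
    { edge = quotientEdge q
    ; sym  = quotientEdge-sym q
    ; loop = λ a → quotientKind-cong (dec-true (a ≟ a) refl) refl refl
    }

  quotient-injective : ∀ {K} (q : Fin N → Fin K) → Injective _≡_ _≡_ q → (∀ x y → edge G x y ≢ red) →
                       ∀ a b → edge (quotient q) (q a) (q b) ≡ edge G a b
  quotient-injective q q-inj noRed a b with a ≟ b
  ... | yes refl = trans (quotientKind-cong (dec-true (q a ≟ q a) refl) refl refl) (sym (Trigraph.loop G a))
  ... | no a≢b   = trans (quotientEdge-≢ q (a≢b ∘ q-inj)) (kind (edge G a b) refl)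
    where
    onlyPair : ∀ {x y} → q x ≡ q a → q y ≡ q b → edge G x y ≡ edge G a b
    onlyPair qx qy = cong₂ (edge G) (q-inj qx) (q-inj qy)
    kind : ∀ k → edge G a b ≡ k →
           bundleKind (does (someNonBlack? q (q a) (q b))) (does (someBlack? q (q a) (q b))) ≡ k
    kind black ab≡black = cong₂ bundleKind
      (dec-false (someNonBlack? q (q a) (q b)) λ (_ , _ , qx , qy , xy≢black) →
         xy≢black (trans (onlyPair qx qy) ab≡black))
      refl
    kind none ab≡none = cong₂ bundleKind
      (dec-true (someNonBlack? q (q a) (q b)) (a , b , refl , refl , λ ab≡black →
         none≢black (trans (sym ab≡none) ab≡black)))
      (dec-false (someBlack? q (q a) (q b)) λ (_ , _ , qx , qy , xy≡black) →
         none≢black (trans (sym ab≡none) (trans (sym (onlyPair qx qy)) xy≡black)))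
    kind red ab≡red = ⊥-elim (noRed a b ab≡red)

  quotient-inhabited : ∀ {K} {q : Fin N → Fin K} → StrictlySurjective _≡_ q →
                       ∀ a b → does (someNonBlack? q a b) ∨ does (someBlack? q a b) ≡ true
  quotient-inhabited {q = q} q-surj a b
    with xa , refl ← q-surj a | xb , refl ← q-surj b | edge G xa xb ≟ₑ black
  ... | yes e = trans (cong (does (someNonBlack? q (q xa) (q xb)) ∨_)
                            (dec-true (someBlack? q (q xa) (q xb)) (xa , xb , refl , refl , e)))
                      (∨-zeroʳ _)
  ... | no ne = cong (_∨ does (someBlack? q (q xa) (q xb)))
                     (dec-true (someNonBlack? q (q xa) (q xb)) (xa , xb , refl , refl , ne))

  module _ {k} {q : Fin N → Fin (suc k)} {u v : Fin (suc k)} {f : Fin (suc k) → Fin k}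
           (isMerge : IsMerge u v f) where
    open IsMerge isMerge

    Pairs-∘-kept : ∀ P {x y} → x ≢ u → x ≢ v → y ≢ u → y ≢ v →
                   Pairs (f ∘ q) P (f x) (f y) ⇔ Pairs q P x y
    Pairs-∘-kept _ x≢u x≢v y≢u y≢v = mk⇔
      (λ (z , w , qz , qw , p) → z , w , fiber-kept x≢u x≢v qz , fiber-kept y≢u y≢v qw , p)
      (λ (z , w , qz , qw , p) → z , w , cong f qz , cong f qw , p)

    Pairs-∘-merged : ∀ P {x} → x ≢ u → x ≢ v →
                     Pairs (f ∘ q) P (f u) (f x) ⇔ (Pairs q P u x ⊎ Pairs q P v x)
    Pairs-∘-merged _ x≢u x≢v = mk⇔
      (λ (z , w , qz , qw , p) → Sum.map (λ qz≡u → z , w , qz≡u , fiber-kept x≢u x≢v qw , p)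
                                         (λ qz≡v → z , w , qz≡v , fiber-kept x≢u x≢v qw , p)
                                         (fiber-merged qz))
      Sum.[ (λ (z , w , qz , qw , p) → z , w , cong f qz , cong f qw , p)
          , (λ (z , w , qz , qw , p) → z , w , trans (cong f qz) (sym fu≡fv) , cong f qw , p) ]

  quotient-contraction : ∀ {k} {q : Fin N → Fin (suc k)} {u v f} → StrictlySurjective _≡_ q →
                         IsMerge u v f → ContractionOf (quotient q) (quotient (f ∘ q))
  quotient-contraction {q = q} {u} {v} {f} q-surj isMerge = record
    { u = u ; v = v ; u≢v = u≢v ; f = f ; fu≡fv = fu≡fv ; f-inj = f-inj ; f-surj = f-surj
    ; keep = keep ; new = new }
    where
    open IsMerge isMerge
    keep : ∀ x y → x ≢ u → x ≢ v → y ≢ u → y ≢ v →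
           quotientEdge (f ∘ q) (f x) (f y) ≡ quotientEdge q x y
    keep x y x≢u x≢v y≢u y≢v = quotientKind-cong
      (does-⇔ (mk⇔ (fiber-kept y≢u y≢v) (cong f)) (f x ≟ f y) (x ≟ y))
      (does-⇔ (Pairs-∘-kept isMerge (_≢ black) x≢u x≢v y≢u y≢v)
              (someNonBlack? (f ∘ q) (f x) (f y)) (someNonBlack? q x y))
      (does-⇔ (Pairs-∘-kept isMerge (_≡ black) x≢u x≢v y≢u y≢v)
              (someBlack? (f ∘ q) (f x) (f y)) (someBlack? q x y))
    new : ∀ x → x ≢ u → x ≢ v →
          quotientEdge (f ∘ q) (f u) (f x) ≡ merge (quotientEdge q u x) (quotientEdge q v x)
    new x x≢u x≢v = begin
      quotientEdge (f ∘ q) (f u) (f x)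
        ≡⟨ quotientKind-cong (dec-false (f u ≟ f x) (λ e → x≢u (sym (fiber-kept x≢u x≢v e))))
             (does-⇔ (Pairs-∘-merged isMerge (_≢ black) x≢u x≢v) (someNonBlack? (f ∘ q) (f u) (f x))
                     (someNonBlack? q u x ⊎-dec someNonBlack? q v x))
             (does-⇔ (Pairs-∘-merged isMerge (_≡ black) x≢u x≢v) (someBlack? (f ∘ q) (f u) (f x))
                     (someBlack? q u x ⊎-dec someBlack? q v x)) ⟩
      bundleKind (does (someNonBlack? q u x) ∨ does (someNonBlack? q v x))
                 (does (someBlack? q u x) ∨ does (someBlack? q v x))
        ≡⟨ bundleKind-∨ _ _ _ _ (quotient-inhabited q-surj u x) (quotient-inhabited q-surj v x) ⟩
      merge (bundleKind (does (someNonBlack? q u x)) (does (someBlack? q u x)))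
            (bundleKind (does (someNonBlack? q v x)) (does (someBlack? q v x)))
        ≡⟨ cong₂ merge (quotientEdge-≢ q (x≢u ∘ sym)) (quotientEdge-≢ q (x≢v ∘ sym)) ⟨
      merge (quotientEdge q u x) (quotientEdge q v x) ∎
      where open ≡-Reasoning

mergeLast : ∀ {k} → Fin k → Fin (suc k) → Fin k
mergeLast w i with view i
... | ‵fromℕ     = w
... | ‵inject₁ j = j

mergeLast-isMerge : ∀ {k} (w : Fin k) → IsMerge (inject₁ w) (fromℕ k) (mergeLast w)
mergeLast-isMerge {k} w = record
  { u≢v    = fromℕ≢inject₁ ∘ sym
  ; fu≡fv  = trans (mergeLast-inject₁ w) (sym mergeLast-fromℕ)
  ; f-inj  = inj
  ; f-surj = λ a → inject₁ a , mergeLast-inject₁ a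
  }
  where
  mergeLast-inject₁ : ∀ j → mergeLast w (inject₁ j) ≡ j
  mergeLast-inject₁ j rewrite view-inject₁ j = refl
  mergeLast-fromℕ : mergeLast w (fromℕ k) ≡ w
  mergeLast-fromℕ rewrite view-fromℕ k = refl
  inj : ∀ x y → mergeLast w x ≡ mergeLast w y →
        x ≡ y ⊎ ((x ≡ inject₁ w × y ≡ fromℕ k) ⊎ (x ≡ fromℕ k × y ≡ inject₁ w))
  inj x y e with view x | view y
  ... | ‵fromℕ     | ‵fromℕ     = inj₁ refl
  ... | ‵fromℕ     | ‵inject₁ j = inj₂ (inj₂ (refl , cong inject₁ (sym e)))
  ... | ‵inject₁ i | ‵fromℕ     = inj₂ (inj₁ (cong inject₁ e , refl))
  ... | ‵inject₁ i | ‵inject₁ j = inj₁ (cong inject₁ e)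

toℕ-mergeLast-< : ∀ {k} (w : Fin k) y → toℕ y < k → toℕ (mergeLast w y) ≡ toℕ y
toℕ-mergeLast-< w y y<k with view y
... | ‵fromℕ     = ⊥-elim (<-irrefl (toℕ-fromℕ _) y<k)
... | ‵inject₁ j = sym (toℕ-inject₁ j)

mergeLast-≮ : ∀ {k} (w : Fin k) y → ¬ toℕ y < k → mergeLast w y ≡ w
mergeLast-≮ w y y≮k with view y
... | ‵fromℕ     = refl
... | ‵inject₁ j = ⊥-elim (y≮k (subst (_< _) (sym (toℕ-inject₁ j)) (toℕ<n j)))

-- The contraction sequence of a cycle of half-graphs

-- At stage K of the first phase, a vertex (p, i) with i * ℓ + p < K is still a singleton and every
-- other vertex of column p has been merged into the highest such row, level K p i. Absent K p r says
-- that row r of column p has been merged away.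
module Levels (ℓ : ℕ) where

  level : ℕ → ℕ → ℕ → ℕ
  level K p zero = zero
  level K p (suc i) with suc i * ℓ + p <? K
  ... | yes _ = suc i
  ... | no  _ = level K p i

  Absent : ℕ → ℕ → ℕ → Set
  Absent K p r = K ≤ r * ℓ + p

  level-≤ : ∀ K p i → level K p i ≤ i
  level-≤ K p zero = z≤n
  level-≤ K p (suc i) with suc i * ℓ + p <? K
  ... | yes _ = ≤-refl
  ... | no  _ = m≤n⇒m≤1+n (level-≤ K p i)

  level-exact : ∀ K p i → i * ℓ + p < K → level K p i ≡ i
  level-exact K p zero    _       = refl
  level-exact K p (suc i) present with suc i * ℓ + p <? K
  ... | yes _      = refl
  ... | no  absent = ⊥-elim (absent present)

  level-present : ∀ K p i → p < K → level K p i * ℓ + p < K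
  level-present K p zero    p<K = p<K
  level-present K p (suc i) p<K with suc i * ℓ + p <? K
  ... | yes present = present
  ... | no  _       = level-present K p i p<K

  level<⇒Absent : ∀ K p i → level K p i < i → Absent K p (suc (level K p i))
  level<⇒Absent K p (suc i) lt with suc i * ℓ + p <? K
  ... | yes _ = ⊥-elim (n≮n _ lt)
  ... | no absent with level K p i <? i
  ...   | yes lt′ = level<⇒Absent K p i lt′
  ...   | no  ≮   rewrite ≤-antisym (level-≤ K p i) (≮⇒≥ ≮) = ≮⇒≥ absent

  level-stable : ∀ K p j j′ → j ≤ j′ → Absent K p (suc j) → level K p j′ ≡ level K p j
  level-stable K p j zero      z≤n  _      = refl
  level-stable K p j (suc j′) j≤j′ absent with m≤n⇒m<n∨m≡n j≤j′
  ... | inj₂ refl = refl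
  ... | inj₁ j<1+j′ with suc j′ * ℓ + p <? K
  ...   | yes present = ⊥-elim (<⇒≱ present (≤-trans absent (+-monoˡ-≤ p (*-monoˡ-≤ ℓ j<1+j′))))
  ...   | no  _       = level-stable K p j j′ (≤-pred j<1+j′) absent

  level-ℓ : ∀ p i → level ℓ p i ≡ 0
  level-ℓ p zero = refl
  level-ℓ p (suc i) with suc i * ℓ + p <? ℓ
  ... | yes present = ⊥-elim (<⇒≱ present (≤-trans (m≤m+n ℓ (i * ℓ)) (m≤m+n _ p)))
  ... | no  _       = level-ℓ p i

  level-suc : 1 ≤ ℓ → ∀ k p i → p < k →
                (level (suc k) p i * ℓ + p < k × level k p i ≡ level (suc k) p i)
              ⊎ (level (suc k) p i * ℓ + p ≡ k × level (suc k) p i ≡ suc (level k p i))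
  level-suc 1≤ℓ k p zero    p<k = inj₁ (p<k , refl)
  level-suc 1≤ℓ k p (suc i) p<k with suc i * ℓ + p <? suc k | suc i * ℓ + p <? k
  ... | yes _        | yes present = inj₁ (present , refl)
  ... | yes present′ | no  absent  = inj₂ (atK , cong suc (sym (level-exact k p i below)))
    where
    atK : suc i * ℓ + p ≡ k
    atK = ≤-antisym (≤-pred present′) (≮⇒≥ absent)
    below : i * ℓ + p < k
    below = <-≤-trans (+-monoˡ-< p (m<n+m (i * ℓ) 1≤ℓ)) (≤-reflexive atK)
  ... | no absent′ | yes present = ⊥-elim (absent′ (m<n⇒m<1+n present))
  ... | no _       | no _        = level-suc 1≤ℓ k p i p<k

  collision⇒level< : ∀ K p i i′ → level K p i ≡ level K p i′ → i ≢ i′ →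
                     level K p i < i ⊎ level K p i′ < i′
  collision⇒level< K p i i′ e i≢i′ with level K p i <? i | level K p i′ <? i′
  ... | yes lt | _      = inj₁ lt
  ... | no _   | yes lt = inj₂ lt
  ... | no ≮   | no ≮′  = ⊥-elim (i≢i′ (begin
    i            ≡⟨ ≤-antisym (level-≤ K p i) (≮⇒≥ ≮) ⟨
    level K p i  ≡⟨ e ⟩
    level K p i′ ≡⟨ ≤-antisym (level-≤ K p i′) (≮⇒≥ ≮′) ⟩
    i′           ∎))
    where open ≡-Reasoning

  collision⇒Absent : ∀ K p i i′ → level K p i ≡ level K p i′ → i ≢ i′ →
                     Absent K p (suc (level K p i))
  collision⇒Absent K p i i′ e i≢i′ with collision⇒level< K p i i′ e i≢i′
  ... | inj₁ lt = level<⇒Absent K p i lt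
  ... | inj₂ lt = subst (λ m → Absent K p (suc m)) (sym e) (level<⇒Absent K p i′ lt)

  level-top : ∀ K p j top → level K p j < j → j ≤ top → p < K → level K p j ≡ level K p top
  level-top K p j top lt j≤top p<K = sym (begin
    level K p top ≡⟨ level-stable K p m top (≤-trans (level-≤ K p j) j≤top) (level<⇒Absent K p j lt) ⟩
    level K p m   ≡⟨ level-exact K p m (level-present K p j p<K) ⟩
    m             ∎)
    where
    open ≡-Reasoning
    m = level K p j

  collision⇒top : ∀ K p i i′ top → level K p i ≡ level K p i′ → i ≢ i′ → i ≤ top → i′ ≤ top → p < K →
                  level K p i ≡ level K p top
  collision⇒top K p i i′ top e i≢i′ i≤top i′≤top p<K with collision⇒level< K p i i′ e i≢i′
  ... | inj₁ lt = level-top K p i top lt i≤top p<K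
  ... | inj₂ lt = trans e (level-top K p i′ top lt i′≤top p<K)

  Absent-spread : ∀ K p q m j → Absent K p (suc m) → p < ℓ → suc m ≤ j → Absent K q (suc j)
  Absent-spread K p q m j absent p<ℓ m<j = begin
    K               ≤⟨ absent ⟩
    suc m * ℓ + p   ≤⟨ +-monoʳ-≤ (suc m * ℓ) (<⇒≤ p<ℓ) ⟩
    suc m * ℓ + ℓ   ≡⟨ +-comm (suc m * ℓ) ℓ ⟩
    suc (suc m) * ℓ ≤⟨ *-monoˡ-≤ ℓ (s≤s m<j) ⟩
    suc j * ℓ       ≤⟨ m≤m+n (suc j * ℓ) q ⟩
    suc j * ℓ + q   ∎
    where open ≤-Reasoning

  Absent⇒level-top : ∀ K p q m j top → Absent K p (suc m) → p < ℓ → suc m ≤ j → j ≤ top →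
                     level K q j ≡ level K q top
  Absent⇒level-top K p q m j top absent p<ℓ m<j j≤top =
    sym (level-stable K q j top j≤top (Absent-spread K p q m j absent p<ℓ m<j))

module Cyclic (ℓ : ℕ) where

  next : ℕ → ℕ
  next p = if suc p ≡ᵇ ℓ then 0 else suc p

  prev : ℕ → ℕ
  prev zero    = pred ℓ
  prev (suc p) = p

  prev-next : ∀ p → prev (next p) ≡ p
  prev-next p with suc p ≡ᵇ ℓ in wraps
  ... | true  = cong pred (sym (≡ᵇ⇒≡ (suc p) ℓ (≡true⇒T wraps)))
  ... | false = refl

  next⇒prev : ∀ {p q} → p ≡ next q → q ≡ prev p
  next⇒prev {q = q} p≡next = trans (sym (prev-next q)) (cong prev (sym p≡next))

  IsSuccMod⇒next : ∀ (p q : Fin ℓ) → IsSuccMod ℓ p q ≡ true → toℕ q ≡ next (toℕ p)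
  IsSuccMod⇒next p q s with suc (toℕ p) ≡ᵇ ℓ in wraps | toℕ q ≡ᵇ suc (toℕ p) in succeeds
  ... | false | true  = ≡ᵇ⇒≡ _ _ (≡true⇒T succeeds)
  ... | false | false = ⊥-elim (false≢true (trans (sym (∧-zeroʳ (toℕ q ≡ᵇ 0))) s))
    where false≢true : false ≢ true
          false≢true ()
  ... | true  | true  =
    ⊥-elim (<-irrefl (trans (≡ᵇ⇒≡ _ _ (≡true⇒T succeeds)) (≡ᵇ⇒≡ _ _ (≡true⇒T wraps))) (toℕ<n q))
  ... | true  | false = ≡ᵇ⇒≡ (toℕ q) 0 (≡true⇒T (trans (sym (∧-identityʳ (toℕ q ≡ᵇ 0))) s))

  wrapping⇒≥ : ∀ {k p} → (suc p ≡ᵇ ℓ) ≡ true → suc k ≤ ℓ → k ≤ p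
  wrapping⇒≥ wraps k<ℓ = ≤-pred (≤-trans k<ℓ (≤-reflexive (sym (≡ᵇ⇒≡ _ _ (≡true⇒T wraps)))))

  -- With columns 0, …, k - 1 single parts and the remaining columns merged into part k, the parts
  -- that can be red to part a.
  ColumnNeighbours : ℕ → ℕ → List ℕ
  ColumnNeighbours k a = pred a ∷ suc a ⊓ k ∷ (if a ≡ᵇ 0 then k else 0) ∷ []

  next⊓-neighbour : ∀ k p → suc k ≤ ℓ → next p ⊓ k ∈ ColumnNeighbours k (p ⊓ k)
  next⊓-neighbour k p k<ℓ with suc p ≡ᵇ ℓ in wraps
  ... | false = there (here (sym (suc[m⊓n]⊓n≡suc[m]⊓n p k)))
  ... | true rewrite m≥n⇒m⊓n≡n (wrapping⇒≥ wraps k<ℓ) = zero∈ k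
    where
    zero∈ : ∀ k → 0 ∈ ColumnNeighbours k k
    zero∈ zero    = here refl
    zero∈ (suc k) = there (there (here refl))

  ⊓next-neighbour : ∀ k p → suc k ≤ ℓ → p ⊓ k ∈ ColumnNeighbours k (next p ⊓ k)
  ⊓next-neighbour k p k<ℓ with suc p ≡ᵇ ℓ in wraps
  ... | true = there (there (here (m≥n⇒m⊓n≡n (wrapping⇒≥ wraps k<ℓ))))
  ... | false with p <? k
  ...   | yes p<k rewrite m≤n⇒m⊓n≡m p<k | m≤n⇒m⊓n≡m (<⇒≤ p<k) = here refl
  ...   | no  p≮k rewrite m≥n⇒m⊓n≡n (≤-trans (≮⇒≥ p≮k) (n≤1+n p)) | m≥n⇒m⊓n≡n (≮⇒≥ p≮k) =
            there (here (sym (m≥n⇒m⊓n≡n (n≤1+n k))))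

module HalfGraphCycleSequence (ℓ t : ℕ) (1≤ℓ : 1 ≤ ℓ) where

  N : ℕ
  N = ℓ * t

  G : Trigraph N
  G = HalfGraphCycle ℓ t

  open Quotient G
  open Levels ℓ
  open Cyclic ℓ

  position : Fin N → Fin ℓ × Fin t
  position = remQuot t

  col row : Fin N → ℕ
  col x = toℕ (proj₁ (position x))
  row x = toℕ (proj₂ (position x))

  top : ℕ
  top = pred t

  col<ℓ : ∀ x → col x < ℓ
  col<ℓ x = toℕ<n (proj₁ (position x))

  row≤top : ∀ x → row x ≤ top
  row≤top x = toℕ≤pred[n] (proj₂ (position x))

  adjacent : Fin N → Fin N → Bool
  adjacent x y = halfAdj ℓ t (position x) (position y)

  noRed : ∀ x y → edge G x y ≢ red
  noRed x y with adjacent x y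
  ... | true  = λ ()
  ... | false = λ ()

  edge-≢⇒adjacent-≢ : ∀ {x y x′ y′} → edge G x y ≢ edge G x′ y′ → adjacent x y ≢ adjacent x′ y′
  edge-≢⇒adjacent-≢ ne e = ne (cong (λ b → if b then black else none) e)

  black⇒adjacent : ∀ {x y} → edge G x y ≡ black → adjacent x y ≡ true
  black⇒adjacent {x} {y} e with adjacent x y
  ... | true  = refl
  ... | false = ⊥-elim (none≢black e)

  adjacent⇒next : ∀ {x y} → adjacent x y ≡ true → col y ≡ next (col x) ⊎ col x ≡ next (col y)
  adjacent⇒next {x} {y} adj =
    Sum.map (IsSuccMod⇒next _ _) (IsSuccMod⇒next _ _)
            (∧∨∧≡true (IsSuccMod ℓ (proj₁ (position x)) (proj₁ (position y))) _ adj)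

  adjacent⇒neighbour : ∀ {x y} → adjacent x y ≡ true → col y ≡ next (col x) ⊎ col y ≡ prev (col x)
  adjacent⇒neighbour {x} {y} adj =
    Sum.map id next⇒prev (adjacent⇒next adj)

  adjacent-rows-≢ : ∀ {x y y′} → adjacent x y ≢ adjacent x y′ → col y ≡ col y′ → row y ≢ row y′
  adjacent-rows-≢ {x} ne c r =
    ne (cong (halfAdj ℓ t (position x)) (cong₂ _,_ (toℕ-injective c) (toℕ-injective r)))

  adjacent-≢-column : ∀ {y x x′} → adjacent y x ≢ adjacent y x′ → col x ≡ col x′ →
                        (col x ≡ next (col y) × (row x ≤ row y ⊎ row x′ ≤ row y))
                      ⊎ (col y ≡ next (col x) × (row x < row y ⊎ row x′ < row y))
  adjacent-≢-column {y} {x} {x′} ne col≡ =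
    Sum.map (λ (s , ≢) → IsSuccMod⇒next Q P s , <ᵇ-≢⇒≥ (row x) (row x′) (row y) ≢)
            (λ (s , ≢) → IsSuccMod⇒next P Q s , <ᵇ-≢⇒< (row x) (row x′) (row y) ≢)
            (∧∨∧-≢ (IsSuccMod ℓ Q P) (IsSuccMod ℓ P Q) ne′)
    where
    P = proj₁ (position x)
    Q = proj₁ (position y)
    ne′ : halfAdj ℓ t (position y) (position x) ≢ halfAdj ℓ t (position y) (P , proj₂ (position x′))
    ne′ = subst (λ P′ → halfAdj ℓ t (position y) (position x) ≢
                        halfAdj ℓ t (position y) (P′ , proj₂ (position x′)))
                (toℕ-injective (sym col≡)) ne

  index : ℕ → ℕ → ℕ → ℕ
  index K p i = level K p i * ℓ + p

  LevelPartition : ∀ K → (Fin N → Fin K) → Set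
  LevelPartition K q = ∀ x → toℕ (q x) ≡ index K (col x) (row x)

  module LevelPartitionRedDegree {K} (q : Fin N → Fin K) (ℓ≤K : ℓ ≤ K) (part : LevelPartition K q)
                                 (x₀ : Fin N) where

    p₀ m : ℕ
    p₀ = col x₀
    m  = level K p₀ (row x₀)

    candidates : List ℕ
    candidates = index K (next p₀) top ∷ index K (prev p₀) top ∷ index K (prev p₀) m ∷ []

    samePart : ∀ {x x′} → q x ≡ q x′ →
               col x ≡ col x′ × level K (col x) (row x) ≡ level K (col x) (row x′)
    samePart {x} {x′} e
      with level≡ , col≡ ← *-+-injective ℓ (col<ℓ x) (col<ℓ x′)
                              (trans (sym (part x)) (trans (cong toℕ e) (part x′)))
      = col≡ , trans level≡ (cong (λ c → level K c (row x′)) (sym col≡))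

    partIndex : ∀ {y b} → q y ≡ b → toℕ b ≡ index K (col y) (row y)
    partIndex {y} qy = trans (cong toℕ (sym qy)) (part y)

    level≤row : ∀ {x x′} → q x ≡ q x′ → level K (col x) (row x) ≤ row x′
    level≤row {x} {x′} e = subst (_≤ row x′) (sym (proj₂ (samePart e))) (level-≤ K (col x) (row x′))

    topPart : ∀ {y b c} → q y ≡ b → col y ≡ c → level K (col y) (row y) ≡ level K (col y) top →
              toℕ b ≡ index K c top
    topPart {y} qy refl atTop = trans (partIndex qy) (cong (λ l → l * ℓ + col y) atTop)

    neighbourTop : ∀ {y b} → q y ≡ b → col y ≡ next p₀ ⊎ col y ≡ prev p₀ →
                   level K (col y) (row y) ≡ level K (col y) top → toℕ b ∈ candidates
    neighbourTop qy (inj₁ c) atTop = here (topPart qy c atTop)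
    neighbourTop qy (inj₂ c) atTop = there (here (topPart qy c atTop))

    splitBy : ∀ {b} → Splits q (q x₀) b → toℕ b ∈ candidates
    splitBy (x , y , y′ , qx , qy , qy′ , ne) = neighbourTop qy neighbour atTop
      where
      adj≢ = edge-≢⇒adjacent-≢ ne
      same = samePart (trans qy (sym qy′))
      atTop : level K (col y) (row y) ≡ level K (col y) top
      atTop = collision⇒top K (col y) (row y) (row y′) top (proj₂ same) (adjacent-rows-≢ adj≢ (proj₁ same))
                (row≤top y) (row≤top y′) (<-≤-trans (col<ℓ y) ℓ≤K)
      neighbour : col y ≡ next p₀ ⊎ col y ≡ prev p₀
      neighbour = subst (λ p → col y ≡ next p ⊎ col y ≡ prev p) (proj₁ (samePart qx))
        (Sum.[ adjacent⇒neighbour , subst (λ c → c ≡ next (col x) ⊎ c ≡ prev (col x)) (sym (proj₁ same))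
                                      ∘ adjacent⇒neighbour ]
               (≢⇒true⊎true adj≢))

    splitOf : ∀ {b} → Splits q b (q x₀) → toℕ b ∈ candidates
    splitOf {b} (y , x , x′ , qy , qx , qx′ , ne) = result (adjacent-≢-column adj≢ (proj₁ same))
      where
      adj≢ = edge-≢⇒adjacent-≢ ne
      same = samePart (trans qx (sym qx′))
      col≡p₀ = proj₁ (samePart qx)
      mₓ = level K (col x) (row x)
      mₓ≡m : mₓ ≡ m
      mₓ≡m = trans (proj₂ (samePart qx)) (cong (λ c → level K c (row x₀)) col≡p₀)
      above⇒top : suc mₓ ≤ row y → level K (col y) (row y) ≡ level K (col y) top
      above⇒top mₓ<j = Absent⇒level-top K (col x) (col y) mₓ (row y) top
        (collision⇒Absent K (col x) (row x) (row x′) (proj₂ same) (adjacent-rows-≢ adj≢ (proj₁ same)))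
        (col<ℓ x) mₓ<j (row≤top y)
      level≤ : ∀ {j} → row x ≤ j ⊎ row x′ ≤ j → mₓ ≤ j
      level≤ = Sum.[ ≤-trans (level≤row refl) , ≤-trans (level≤row (trans qx (sym qx′))) ]
      level< : ∀ {j} → row x < j ⊎ row x′ < j → suc mₓ ≤ j
      level< = Sum.[ ≤-trans (s≤s (level≤row refl)) , ≤-trans (s≤s (level≤row (trans qx (sym qx′)))) ]
      y≡prev : col x ≡ next (col y) → col y ≡ prev p₀
      y≡prev x≡next = trans (next⇒prev x≡next) (cong prev col≡p₀)
      result : (col x ≡ next (col y) × (row x ≤ row y ⊎ row x′ ≤ row y))
             ⊎ (col y ≡ next (col x) × (row x < row y ⊎ row x′ < row y)) → toℕ b ∈ candidates
      result (inj₂ (y≡next , below)) =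
        neighbourTop qy (inj₁ (trans y≡next (cong next col≡p₀))) (above⇒top (level< below))
      result (inj₁ (x≡next , notAbove)) with m≤n⇒m<n∨m≡n (level≤ notAbove)
      ... | inj₁ mₓ<j = neighbourTop qy (inj₂ (y≡prev x≡next)) (above⇒top mₓ<j)
      ... | inj₂ mₓ≡j =
        there (there (here (trans (partIndex qy)
                                  (cong₂ (index K) (y≡prev x≡next) (trans (sym mₓ≡j) mₓ≡m)))))

  levelPartition-redDeg : ∀ {K} (q : Fin N → Fin K) → ℓ ≤ K → StrictlySurjective _≡_ q → LevelPartition K q →
                          RedDegAtMost 3 (quotient q)
  levelPartition-redDeg q ℓ≤K surj part a with x₀ , refl ← surj a =
    redDeg≤length (quotient q) (q x₀) candidates λ b isRed →
      Sum.[ splitBy , splitOf ] (red⇒Splits q (q x₀) b isRed)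
    where open LevelPartitionRedDegree q ℓ≤K part x₀

  LevelPartition-mergeLast : ∀ K (q : Fin N → Fin (suc K)) (w : Fin K) → ℓ ≤ K → toℕ w ≡ K ∸ ℓ →
                             LevelPartition (suc K) q → LevelPartition K (mergeLast w ∘ q)
  LevelPartition-mergeLast K q w ℓ≤K w≡ part x
    with level-suc 1≤ℓ K (col x) (row x) (<-≤-trans (col<ℓ x) ℓ≤K)
  ... | inj₁ (below , same) = begin
    toℕ (mergeLast w (q x)) ≡⟨ toℕ-mergeLast-< w (q x) (subst (_< K) (sym (part x)) below) ⟩
    toℕ (q x)               ≡⟨ part x ⟩
    index (suc K) p i       ≡⟨ cong (λ l → l * ℓ + p) same ⟨
    index K p i             ∎
    where open ≡-Reasoning; p = col x; i = row x
  ... | inj₂ (atK , succ) = begin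
    toℕ (mergeLast w (q x))         ≡⟨ cong toℕ (mergeLast-≮ w (q x) (<-irrefl (trans (part x) atK))) ⟩
    toℕ w                           ≡⟨ w≡ ⟩
    K ∸ ℓ                           ≡⟨ cong (_∸ ℓ) atK ⟨
    level (suc K) p i * ℓ + p ∸ ℓ   ≡⟨ cong (λ l → l * ℓ + p ∸ ℓ) succ ⟩
    ℓ + level K p i * ℓ + p ∸ ℓ     ≡⟨ cong (_∸ ℓ) (+-assoc ℓ (level K p i * ℓ) p) ⟩
    ℓ + (level K p i * ℓ + p) ∸ ℓ   ≡⟨ m+n∸m≡n ℓ _ ⟩
    index K p i                     ∎
    where open ≡-Reasoning; p = col x; i = row x

  ColumnPartition : ∀ K → (Fin N → Fin K) → Set
  ColumnPartition K q = ∀ x → toℕ (q x) ≡ col x ⊓ pred K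

  LevelPartition⇒ColumnPartition : ∀ q → LevelPartition ℓ q → ColumnPartition ℓ q
  LevelPartition⇒ColumnPartition q part x = begin
    toℕ (q x)              ≡⟨ part x ⟩
    index ℓ (col x) (row x) ≡⟨ cong (λ l → l * ℓ + col x) (level-ℓ (col x) (row x)) ⟩
    col x                  ≡⟨ m≤n⇒m⊓n≡m (<⇒≤pred (col<ℓ x)) ⟨
    col x ⊓ pred ℓ         ∎
    where open ≡-Reasoning

  ColumnPartition-mergeLast : ∀ k (q : Fin N → Fin (suc (suc k))) → ColumnPartition (suc (suc k)) q →
                              ColumnPartition (suc k) (mergeLast (fromℕ k) ∘ q)
  ColumnPartition-mergeLast k q part x with toℕ (q x) <? suc k
  ... | yes lt = trans (toℕ-mergeLast-< _ (q x) lt)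
                   (trans (part x) (m⊓[1+n]<1+n⇒m⊓[1+n]≡m⊓n (col x) k (subst (_< suc k) (part x) lt)))
  ... | no ≮   = trans (cong toℕ (mergeLast-≮ _ (q x) ≮))
                   (trans (toℕ-fromℕ k)
                          (sym (m⊓[1+n]≮1+n⇒m⊓n≡n (col x) k (≮ ∘ subst (_< suc k) (sym (part x))))))

  columnPartition-redDeg : ∀ k (q : Fin N → Fin (suc k)) → suc k ≤ ℓ → ColumnPartition (suc k) q →
                           RedDegAtMost 3 (quotient q)
  columnPartition-redDeg k q k<ℓ part a = redDeg≤length (quotient q) a (ColumnNeighbours k (toℕ a)) neighbour
    where
    partOf : ∀ {z c} → q z ≡ c → toℕ c ≡ col z ⊓ k
    partOf {z} qz = trans (cong toℕ (sym qz)) (part z)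
    neighbour : ∀ b → quotientEdge q a b ≡ red → toℕ b ∈ ColumnNeighbours k (toℕ a)
    neighbour b isRed with x , y , qx , qy , xy≡black ← proj₂ (red⇒pairs q a b isRed) =
      subst₂ (λ u v → u ∈ ColumnNeighbours k v) (sym (partOf qy)) (sym (partOf qx))
             (columns (adjacent⇒next (black⇒adjacent xy≡black)))
      where
      columns : col y ≡ next (col x) ⊎ col x ≡ next (col y) → col y ⊓ k ∈ ColumnNeighbours k (col x ⊓ k)
      columns (inj₁ y≡next) = subst (λ c → c ⊓ k ∈ ColumnNeighbours k (col x ⊓ k)) (sym y≡next)
                                    (next⊓-neighbour k (col x) k<ℓ)
      columns (inj₂ x≡next) = subst (λ c → col y ⊓ k ∈ ColumnNeighbours k (c ⊓ k)) (sym x≡next)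
                                    (⊓next-neighbour k (col y) k<ℓ)

  columnPhase : ∀ K (q : Fin N → Fin K) → K ≤ ℓ → StrictlySurjective _≡_ q → ColumnPartition K q →
                HasDSequence 3 (quotient q)
  columnPhase zero          q _   _    _    = λ ()
  columnPhase (suc zero)    q K≤ℓ _    part = columnPartition-redDeg 0 q K≤ℓ part
  columnPhase (suc (suc k)) q K≤ℓ surj part =
    columnPartition-redDeg (suc k) q K≤ℓ part ,
    quotient (mergeLast w ∘ q) ,
    quotient-contraction surj (mergeLast-isMerge w) ,
    columnPhase (suc k) (mergeLast w ∘ q) (≤-trans (n≤1+n _) K≤ℓ)
      (StrictlySurjective-∘ surj (IsMerge.f-surj (mergeLast-isMerge w))) (ColumnPartition-mergeLast k q part)
    where w = fromℕ k

  levelPhase : ∀ K (q : Fin N → Fin K) → ℓ ≤ K → StrictlySurjective _≡_ q → LevelPartition K q →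
               HasDSequence 3 (quotient q)
  levelPhase K q ℓ≤K surj part with ℓ ℕₚ.≟ K
  ... | yes refl = columnPhase ℓ q ≤-refl surj (LevelPartition⇒ColumnPartition q part)
  levelPhase zero          q ℓ≤0 _    _    | no _    = ⊥-elim (<⇒≱ 1≤ℓ ℓ≤0)
  levelPhase (suc zero)    q ℓ≤1 _    _    | no ℓ≢1 = ⊥-elim (ℓ≢1 (≤-antisym ℓ≤1 1≤ℓ))
  levelPhase (suc (suc k)) q ℓ≤K surj part | no ℓ≢K =
    levelPartition-redDeg q ℓ≤K surj part ,
    quotient (mergeLast w ∘ q) ,
    quotient-contraction surj (mergeLast-isMerge w) ,
    levelPhase (suc k) (mergeLast w ∘ q) ℓ≤1+k
      (StrictlySurjective-∘ surj (IsMerge.f-surj (mergeLast-isMerge w)))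
      (LevelPartition-mergeLast (suc k) q w ℓ≤1+k (toℕ-fromℕ< _) part)
    where
    ℓ≤1+k : ℓ ≤ suc k
    ℓ≤1+k = ≤-pred (≤∧≢⇒< ℓ≤K ℓ≢K)
    w : Fin (suc k)
    w = fromℕ< (∸-monoʳ-< 1≤ℓ ℓ≤1+k)

  rowMajor : Fin N → Fin N
  rowMajor x = cast (*-comm t ℓ) (combine (proj₂ (position x)) (proj₁ (position x)))

  rowMajor⁻¹ : Fin N → Fin N
  rowMajor⁻¹ y = uncurry (flip combine) (remQuot {t} ℓ (cast (*-comm ℓ t) y))

  rowMajor-inverseˡ : ∀ y → rowMajor (rowMajor⁻¹ y) ≡ y
  rowMajor-inverseˡ y = begin
    rowMajor (combine p i)
      ≡⟨ cong (λ (p′ , i′) → cast (*-comm t ℓ) (combine i′ p′)) (remQuot-combine p i) ⟩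
    cast (*-comm t ℓ) (combine i p)
      ≡⟨ cong (cast (*-comm t ℓ)) (combine-remQuot {t} ℓ y′) ⟩
    cast (*-comm t ℓ) y′
      ≡⟨ cast-involutive (*-comm t ℓ) (*-comm ℓ t) y ⟩
    y ∎
    where
    open ≡-Reasoning
    y′ = cast (*-comm ℓ t) y
    i = proj₁ (remQuot {t} ℓ y′)
    p = proj₂ (remQuot {t} ℓ y′)

  rowMajor-inverseʳ : ∀ x → rowMajor⁻¹ (rowMajor x) ≡ x
  rowMajor-inverseʳ x = begin
    rowMajor⁻¹ (rowMajor x)
      ≡⟨ cong (uncurry (flip combine) ∘ remQuot ℓ) (cast-involutive (*-comm ℓ t) (*-comm t ℓ) (combine i p)) ⟩
    uncurry (flip combine) (remQuot ℓ (combine i p))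
      ≡⟨ cong (uncurry (flip combine)) (remQuot-combine i p) ⟩
    combine p i
      ≡⟨ combine-remQuot {ℓ} t x ⟩
    x ∎
    where
    open ≡-Reasoning
    p = proj₁ (position x)
    i = proj₂ (position x)

  rowMajor-injective : Injective _≡_ _≡_ rowMajor
  rowMajor-injective {x} {y} e =
    trans (sym (rowMajor-inverseʳ x)) (trans (cong rowMajor⁻¹ e) (rowMajor-inverseʳ y))

  toℕ-rowMajor : ∀ x → toℕ (rowMajor x) ≡ row x * ℓ + col x
  toℕ-rowMajor x = begin
    toℕ (rowMajor x)        ≡⟨ toℕ-cast (*-comm t ℓ) _ ⟩
    toℕ (combine i p)       ≡⟨ toℕ-combine i p ⟩
    ℓ * row x + col x       ≡⟨ cong (_+ col x) (*-comm ℓ (row x)) ⟩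
    row x * ℓ + col x       ∎
    where
    open ≡-Reasoning
    p = proj₁ (position x)
    i = proj₂ (position x)

  rowMajor-partition : LevelPartition N rowMajor
  rowMajor-partition x =
    trans (toℕ-rowMajor x) (cong (λ l → l * ℓ + col x) (sym (level-exact N (col x) (row x) row-major<N)))
    where
    row-major<N : row x * ℓ + col x < N
    row-major<N = subst (_< N) (toℕ-rowMajor x) (toℕ<n (rowMajor x))

lemma8 : (ℓ t : ℕ) → 1 ≤ ℓ → 1 ≤ t → TwinWidthAtMost 3 (HalfGraphCycle ℓ t)
lemma8 ℓ t 1≤ℓ 1≤t =
  HasDSequence-relabel G (quotient rowMajor) rowMajor rowMajor⁻¹ rowMajor-inverseˡ rowMajor-inverseʳ
    (λ a b → sym (quotient-injective rowMajor rowMajor-injective noRed a b))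
    (noRed⇒RedDegAtMost 3 G noRed)
    (levelPhase N rowMajor ℓ≤N (λ y → rowMajor⁻¹ y , rowMajor-inverseˡ y) rowMajor-partition)
  where
  open HalfGraphCycleSequence ℓ t 1≤ℓ
  open Quotient G
  ℓ≤N : ℓ ≤ N
  ℓ≤N = ≤-trans (≤-reflexive (sym (*-identityʳ ℓ))) (*-monoʳ-≤ ℓ 1≤t)
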